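{- Let $G$ be a 2-connected graph that has no proper $K_2$-cutset. Let $(\{u,v\},K',K'')$ be a split of a proper $S_2$-cutset of $G$ (so neither $G[K'\cup\{u,v\}]$ nor $G[K''\cup\{u,v\}]$ is a chordless $uv$-path), and let $G'$ be the graph obtained from $G[K'\cup\{u,v\}]$ by adding new nodes $u',v'$ and edges $uu',u'v',v'v$, and $G''$ the graph obtained from $G[K''\cup\{u,v\}]$ by adding new nodes $u'',v''$ and edges $uu'',u''v'',v''v$. Then $G$ does not contain a propeller as a subgraph if and only if neither $G'$ nor $G''$ contains a propeller as a subgraph.
   Context: All graphs are finite, simple and undirected. A propeller $(C,x)$ is a graph consisting of a chordless cycle $C$ (the rim) and a node $x\notin V(C)$ (the center) that has at least two neighbors on $C$. A graph is 2-connected if removing fewer than 2 nodes never leaves a disconnected graph or a single node. A $K_2$-cutset is a set $\{a,b\}$ with $ab\in E(G)$ such that $G\setminus\{a,b\}$ is disconnected; it is proper if no node of $G\setminus\{a,b\}$ is adjacent to both $a$ and $b$. An $S_2$-cutset is a set $\{a,b\}$ with $ab\notin E(G)$ such that $G\setminus\{a,b\}$ is disconnected. A split $(\{a,b\},C_1,C_2)$ of it is a partition of $V(G)\setminus\{a,b\}$ into nonempty sets with no edge between $C_1$ and $C_2$. -}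

module Defs where

open import Data.Nat using (ℕ; zero; suc)
open import Data.Fin as F using (Fin; toℕ; fromℕ)
open import Data.Bool using (Bool; true; false; T; _∨_; not)
open import Data.Bool.Properties using (T-irrelevant)
open import Data.Product using (Σ; _×_; _,_; proj₁; proj₂)
open import Data.Sum using (_⊎_; inj₁; inj₂)
open import Data.Sum.Properties using (≡-dec)
open import Data.Empty using (⊥)
open import Relation.Nullary using (¬_; yes; no; Dec)
open import Relation.Nullary.Decidable using (⌊_⌋)
open import Relation.Binary.Definitions using (DecidableEquality)
open import Relation.Binary.PropositionalEquality using (_≡_; _≢_; refl; cong)
open import Function.Definitions using (Injective)
open import Function.Bundles using (_↔_)

record Graph : Set₁ where
  field
    V      : Set
    _≟_    : DecidableEquality V
    E      : V → V → Bool
    E-sym  : ∀ x y → E x y ≡ E y x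
    E-irr  : ∀ x → E x x ≡ false

open Graph public

Adj : (G : Graph) → V G → V G → Set
Adj G x y = E G x y ≡ true

Finite : Graph → Set
Finite G = Σ ℕ λ n → V G ↔ Fin n

data Reach (G : Graph) (P : V G → Set) : V G → V G → Set where
  here : ∀ {x} → P x → Reach G P x x
  step : ∀ {x y z} → P x → Adj G x y → Reach G P y z → Reach G P x z

DisconnectedAfter : (G : Graph) → (V G → Set) → Set
DisconnectedAfter G D =
  Σ (V G) λ x → Σ (V G) λ y →
    ¬ D x × ¬ D y × ¬ Reach G (λ z → ¬ D z) x y

SingleNodeAfter : (G : Graph) → (V G → Set) → Set
SingleNodeAfter G D = Σ (V G) λ x → ¬ D x × (∀ y → ¬ D y → y ≡ x)

BadAfter : (G : Graph) → (V G → Set) → Set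
BadAfter G D = DisconnectedAfter G D ⊎ SingleNodeAfter G D

-- removing fewer than 2 nodes (none, or one node a) never leaves a
-- disconnected graph or a single node
TwoConnected : Graph → Set
TwoConnected G = ¬ BadAfter G (λ _ → ⊥) × (∀ a → ¬ BadAfter G (λ z → z ≡ a))

Pair : (G : Graph) → V G → V G → V G → Set
Pair G a b z = z ≡ a ⊎ z ≡ b

K2Cutset : (G : Graph) → V G → V G → Set
K2Cutset G a b = Adj G a b × DisconnectedAfter G (Pair G a b)

ProperK2Cutset : (G : Graph) → V G → V G → Set
ProperK2Cutset G a b =
  K2Cutset G a b × (∀ c → ¬ Pair G a b c → ¬ (Adj G a c × Adj G b c))

S2Cutset : (G : Graph) → V G → V G → Set
S2Cutset G a b = a ≢ b × ¬ Adj G a b × DisconnectedAfter G (Pair G a b)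

record Split (G : Graph) (a b : V G) : Set where
  field
    C₁ C₂   : V G → Bool
    out₁    : ∀ x → C₁ x ≡ true → ¬ Pair G a b x
    out₂    : ∀ x → C₂ x ≡ true → ¬ Pair G a b x
    cover   : ∀ x → ¬ Pair G a b x → C₁ x ≡ true ⊎ C₂ x ≡ true
    disj    : ∀ x → C₁ x ≡ true → C₂ x ≡ true → ⊥
    ne₁     : Σ (V G) λ x → C₁ x ≡ true
    ne₂     : Σ (V G) λ x → C₂ x ≡ true
    no-edge : ∀ x y → C₁ x ≡ true → C₂ y ≡ true → ¬ Adj G x y

open Split public

WithPair : (G : Graph) → (V G → Bool) → V G → V G → V G → Bool
WithPair G C a b x = C x ∨ (⌊ _≟_ G x a ⌋ ∨ ⌊ _≟_ G x b ⌋)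

Induced : (G : Graph) → (V G → Bool) → Graph
Induced G S = record
  { V     = Σ (V G) (λ x → T (S x))
  ; _≟_   = dec
  ; E     = λ x y → E G (proj₁ x) (proj₁ y)
  ; E-sym = λ x y → E-sym G (proj₁ x) (proj₁ y)
  ; E-irr = λ x → E-irr G (proj₁ x)
  }
  where
  dec : DecidableEquality (Σ (V G) (λ x → T (S x)))
  dec (x , p) (y , q) with _≟_ G x y
  ... | yes refl = yes (cong (x ,_) (T-irrelevant p q))
  ... | no x≢y   = no λ eq → x≢y (cong proj₁ eq)

-- G[S] is a chordless path from a to b (a, b vertices of G lying in S):
-- an enumeration f 0 = a, …, f k = b of exactly the nodes of S, without
-- repetition, such that two of them are adjacent iff consecutive.
InducedChordlessPath : (G : Graph) → (V G → Bool) → V G → V G → Set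
InducedChordlessPath G S a b =
  Σ ℕ λ k → Σ (Fin (suc k) → V G) λ f →
    Injective _≡_ _≡_ f ×
    f F.zero ≡ a × f (fromℕ k) ≡ b ×
    (∀ i → S (f i) ≡ true) ×
    (∀ x → S x ≡ true → Σ (Fin (suc k)) λ i → f i ≡ x) ×
    (∀ i j → Adj G (f i) (f j) → suc (toℕ i) ≡ toℕ j ⊎ suc (toℕ j) ≡ toℕ i) ×
    (∀ i j → suc (toℕ i) ≡ toℕ j ⊎ suc (toℕ j) ≡ toℕ i → Adj G (f i) (f j))

-- Adding two new nodes p (= inj₂ zero) and q (= inj₂ (suc zero)) to H
-- with edges a–p, p–q, q–b, where the nodes a, b of H are singled out
-- by the Boolean tests isA, isB (true at exactly one node each).

private
  EAdd : (H : Graph) → (V H → Bool) → (V H → Bool) →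
         V H ⊎ Fin 2 → V H ⊎ Fin 2 → Bool
  EAdd H isA isB (inj₁ x) (inj₁ y) = E H x y
  EAdd H isA isB (inj₁ x) (inj₂ F.zero) = isA x
  EAdd H isA isB (inj₁ x) (inj₂ (F.suc F.zero)) = isB x
  EAdd H isA isB (inj₂ F.zero) (inj₁ y) = isA y
  EAdd H isA isB (inj₂ (F.suc F.zero)) (inj₁ y) = isB y
  EAdd H isA isB (inj₂ F.zero) (inj₂ F.zero) = false
  EAdd H isA isB (inj₂ F.zero) (inj₂ (F.suc F.zero)) = true
  EAdd H isA isB (inj₂ (F.suc F.zero)) (inj₂ F.zero) = true
  EAdd H isA isB (inj₂ (F.suc F.zero)) (inj₂ (F.suc F.zero)) = false

  EAdd-sym : (H : Graph) (isA isB : V H → Bool) → ∀ x y →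
             EAdd H isA isB x y ≡ EAdd H isA isB y x
  EAdd-sym H isA isB (inj₁ x) (inj₁ y) = E-sym H x y
  EAdd-sym H isA isB (inj₁ x) (inj₂ F.zero) = refl
  EAdd-sym H isA isB (inj₁ x) (inj₂ (F.suc F.zero)) = refl
  EAdd-sym H isA isB (inj₂ F.zero) (inj₁ y) = refl
  EAdd-sym H isA isB (inj₂ (F.suc F.zero)) (inj₁ y) = refl
  EAdd-sym H isA isB (inj₂ F.zero) (inj₂ F.zero) = refl
  EAdd-sym H isA isB (inj₂ F.zero) (inj₂ (F.suc F.zero)) = refl
  EAdd-sym H isA isB (inj₂ (F.suc F.zero)) (inj₂ F.zero) = refl
  EAdd-sym H isA isB (inj₂ (F.suc F.zero)) (inj₂ (F.suc F.zero)) = refl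

  EAdd-irr : (H : Graph) (isA isB : V H → Bool) → ∀ x →
             EAdd H isA isB x x ≡ false
  EAdd-irr H isA isB (inj₁ x) = E-irr H x
  EAdd-irr H isA isB (inj₂ F.zero) = refl
  EAdd-irr H isA isB (inj₂ (F.suc F.zero)) = refl

AddPath2 : (H : Graph) → (V H → Bool) → (V H → Bool) → Graph
AddPath2 H isA isB = record
  { V     = V H ⊎ Fin 2
  ; _≟_   = ≡-dec (_≟_ H) F._≟_
  ; E     = EAdd H isA isB
  ; E-sym = EAdd-sym H isA isB
  ; E-irr = EAdd-irr H isA isB
  }

Glue : (G : Graph) → (V G → Bool) → V G → V G → Graph
Glue G C u v =
  AddPath2 (Induced G (WithPair G C u v))
           (λ x → ⌊ _≟_ G (proj₁ x) u ⌋)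
           (λ x → ⌊ _≟_ G (proj₁ x) v ⌋)

-- i and j are consecutive on the cycle 0,1,…,m+2,0
CycNext : (m : ℕ) → Fin (suc (suc (suc m))) → Fin (suc (suc (suc m))) → Set
CycNext m i j = suc (toℕ i) ≡ toℕ j ⊎ (toℕ i ≡ suc (suc m) × toℕ j ≡ 0)

CycAdj : (m : ℕ) → Fin (suc (suc (suc m))) → Fin (suc (suc (suc m))) → Set
CycAdj m i j = CycNext m i j ⊎ CycNext m j i

-- H is a propeller (C, x): its nodes are the center x together with the
-- nodes f 0, …, f (m+2) of the rim C (a cycle of length ≥ 3, chordless:
-- two rim nodes are adjacent iff consecutive), and x has at least two
-- neighbours on C.
IsPropeller : Graph → Set
IsPropeller H =
  Σ ℕ λ m → Σ (Fin (suc (suc (suc m))) → V H) λ f → Σ (V H) λ x →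
    Injective _≡_ _≡_ f ×
    (∀ i → f i ≢ x) ×
    (∀ y → y ≢ x → Σ (Fin (suc (suc (suc m)))) λ i → f i ≡ y) ×
    (∀ i j → Adj H (f i) (f j) → CycAdj m i j) ×
    (∀ i j → CycAdj m i j → Adj H (f i) (f j)) ×
    (Σ (Fin (suc (suc (suc m)))) λ i → Σ (Fin (suc (suc (suc m)))) λ j →
       i ≢ j × Adj H x (f i) × Adj H x (f j))

SubgraphOf : Graph → Graph → Set
SubgraphOf H G =
  Σ (V H → V G) λ φ → Injective _≡_ _≡_ φ ×
    (∀ x y → Adj H x y → Adj G (φ x) (φ y))

ContainsPropeller : Graph → Set₁
ContainsPropeller G = Σ Graph λ H → IsPropeller H × SubgraphOf H G

-- Propellers are taken as subgraphs, so a propeller is just a cycle (its rim) together with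
-- a vertex off it having two neighbours on it.
--
-- By 2-connectivity there is a u–v path through each side. Replacing the marker path
-- u u′ v′ v of G′ by such a path through C₂ turns a propeller of G′ into one of G; a
-- propeller of G′ avoiding the markers already is one of G.
--
-- Conversely, the rim of a propeller of G either lies in one side together with u and v,
-- or passes through u and v with its two arcs on different sides. In the latter case the
-- arc on the side of the centre, closed by the marker path, is the rim of a propeller of
-- G′ or G″. In the former case, say for the side C₁, the propeller is one of G′ unless its
-- centre x lies in C₂ and its spokes are u and v. A common neighbour of x and u (or v)
-- would be the centre of a propeller of G″ with rim u x v v″ u″, so, G having no proper
-- K₂-cutset, G ∖ {x, u} and G ∖ {x, v} are connected. If C₂ ≠ {x} this yields a u–v path
-- through C₂ ∖ {x}, which together with the marker path is the rim of a propeller of G″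
-- with centre x; and if C₂ = {x}, then G[C₂ ∪ {u, v}] is the chordless path u x v.

module Submission where

open import Defs
open import Data.Nat using (ℕ; zero; suc; _≤_; s≤s; z≤n)
import Data.Nat as ℕ
import Data.Nat.Properties as ℕ
open import Data.Fin as Fin using (Fin; zero; suc; toℕ; fromℕ; inject₁)
open import Data.Fin.Properties using (toℕ-inject₁; toℕ-fromℕ)
open import Data.Bool using (Bool; true; false; T)
open import Data.Bool.Properties using (∨-comm; T-irrelevant; T-≡)
open import Data.Unit using (⊤; tt)
import Data.Unit.Properties as Unit
open import Data.List
  using (List; []; _∷_; _++_; _∷ʳ_; map; length; tabulate; lookup; initLast; _∷ʳ′_)
open import Data.List.Properties using (++-assoc; map-++; length-map; length-tabulate)
open import Data.List.Membership.Propositional using (_∈_; _∉_)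
open import Data.List.Membership.Propositional.Properties
  using (∈-∃++; ∈-++⁺ˡ; ∈-++⁺ʳ; ∈-++⁻; ∈-map⁺; ∈-map⁻; ∈-tabulate⁺; ∈-tabulate⁻;
         ∈-lookup; ∈-length)
import Data.List.Membership.DecPropositional as DecMembership
open import Data.List.Relation.Unary.All as All using (All; []; _∷_)
import Data.List.Relation.Unary.All.Properties as All
open import Data.List.Relation.Unary.Any using (here; there; index)
import Data.List.Relation.Unary.Any.Properties as Any
open import Data.List.Relation.Unary.Linked as Linked using (Linked; []; [-]; _∷_)
open import Data.List.Relation.Unary.Unique.Propositional as Unique using (Unique; []; _∷_)
import Data.List.Relation.Unary.Unique.Propositional.Properties as Unique
open import Data.List.Relation.Binary.Disjoint.Propositional using (Disjoint)
open import Data.List.Relation.Binary.Subset.Propositional using (_⊆_)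
import Data.List.Relation.Binary.Permutation.Propositional.Properties as ↭
open import Data.Product using (Σ; _×_; _,_; proj₁; proj₂; uncurry)
open import Data.Sum using (_⊎_; inj₁; inj₂)
import Data.Sum as Sum
open import Data.Sum.Properties using (≡-dec)
open import Data.Empty using (⊥; ⊥-elim)
open import Function using (_∘_; Equivalence)
open import Relation.Nullary using (¬_; yes; no; Dec; does)
open import Relation.Nullary.Decidable using (⌊_⌋; T?; dec-true; dec-false; _×-dec_; _⊎-dec_)
open import Relation.Binary.PropositionalEquality using (_≡_; _≢_; refl; sym; trans; cong; subst; subst₂)

-- Linked and repetition-free lists

module _ {A : Set} {R : A → A → Set} where

  Linked-split : ∀ xs {y ys} → Linked R (xs ++ y ∷ ys) → Linked R (xs ∷ʳ y) × Linked R (y ∷ ys)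
  Linked-split []            l       = [-] , l
  Linked-split (x ∷ [])      (r ∷ l) = r ∷ [-] , l
  Linked-split (x ∷ x′ ∷ xs) (r ∷ l) with Linked-split (x′ ∷ xs) l
  ... | l₁ , l₂ = r ∷ l₁ , l₂

  Linked-join : ∀ xs {y ys} → Linked R (xs ∷ʳ y) → Linked R (y ∷ ys) → Linked R (xs ++ y ∷ ys)
  Linked-join []            _         l = l
  Linked-join (x ∷ [])      (r ∷ [-]) l = r ∷ l
  Linked-join (x ∷ x′ ∷ xs) (r ∷ l₁)  l = r ∷ Linked-join (x′ ∷ xs) l₁ l

  Linked-++⁻ˡ : ∀ xs {ys} → Linked R (xs ++ ys) → Linked R xs
  Linked-++⁻ˡ []            _       = []
  Linked-++⁻ˡ (x ∷ [])      _       = [-]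
  Linked-++⁻ˡ (x ∷ x′ ∷ xs) (r ∷ l) = r ∷ Linked-++⁻ˡ (x′ ∷ xs) l

  Linked-++⁻ʳ : ∀ xs {ys} → Linked R (xs ++ ys) → Linked R ys
  Linked-++⁻ʳ []            l       = l
  Linked-++⁻ʳ (x ∷ [])      [-]     = []
  Linked-++⁻ʳ (x ∷ [])      (r ∷ l) = l
  Linked-++⁻ʳ (x ∷ x′ ∷ xs) (r ∷ l) = Linked-++⁻ʳ (x′ ∷ xs) l

  Linked-rotate : ∀ c xs y ys → Linked R ((c ∷ xs ++ y ∷ ys) ∷ʳ c) →
                  Linked R ((y ∷ ys ++ c ∷ xs) ∷ʳ y)
  Linked-rotate c xs y ys l
    with Linked-split (c ∷ xs) (subst (Linked R) (++-assoc (c ∷ xs) (y ∷ ys) (c ∷ [])) l)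
  ... | l₁ , l₂ = subst (Linked R) (sym (++-assoc (y ∷ ys) (c ∷ xs) (y ∷ [])))
                    (Linked-join (y ∷ ys) l₂ l₁)

module _ {A : Set} where

  Unique-∷ : ∀ {x : A} {xs} → x ∉ xs → Unique xs → Unique (x ∷ xs)
  Unique-∷ {xs = xs} x∉ u = All.¬Any⇒All¬ xs x∉ ∷ u

  Unique-++⁻ : ∀ (xs : List A) {ys} → Unique (xs ++ ys) → Unique xs × Unique ys × Disjoint xs ys
  Unique-++⁻ []       u        = [] , u , λ { (() , _) }
  Unique-++⁻ (x ∷ xs) (x∉ ∷ u) with Unique-++⁻ xs u
  ... | uxs , uys , disjoint =
    All.++⁻ˡ xs x∉ ∷ uxs , uys ,
    λ { (here refl , y∈) → All.lookup (All.++⁻ʳ xs x∉) y∈ refl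
      ; (there z∈ , y∈) → disjoint (z∈ , y∈) }

  Unique-++-comm : ∀ (xs : List A) {ys} → Unique (xs ++ ys) → Unique (ys ++ xs)
  Unique-++-comm xs u with Unique-++⁻ xs u
  ... | uxs , uys , disjoint = Unique.++⁺ uys uxs λ { (z∈ys , z∈xs) → disjoint (z∈xs , z∈ys) }

module _ {A B : Set} {P : A → Set} (f : A → B) where

  Linked-mapOn : ∀ {R : A → A → Set} {S : B → B → Set} →
                 (∀ {a b} → P a → P b → R a b → S (f a) (f b)) →
                 ∀ {xs} → All P xs → Linked R xs → Linked S (map f xs)
  Linked-mapOn pres []             []      = []
  Linked-mapOn pres (_ ∷ [])       [-]     = [-]
  Linked-mapOn pres (pa ∷ pb ∷ ps) (r ∷ l) = pres pa pb r ∷ Linked-mapOn pres (pb ∷ ps) l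

  Unique-mapOn : (∀ {a b} → P a → P b → f a ≡ f b → a ≡ b) →
                 ∀ {xs} → All P xs → Unique xs → Unique (map f xs)
  Unique-mapOn inj []        []       = []
  Unique-mapOn inj (pa ∷ ps) (a∉ ∷ u) =
    All.map⁺ (All.zipWith (λ (a≢b , pb) fa≡fb → a≢b (inj pa pb fa≡fb)) (a∉ , ps))
    ∷ Unique-mapOn inj ps u

module _ {A : Set} {R : A → A → Set} where

  Linked-tabulate : ∀ {n} (g : Fin (suc n) → A) y →
                    (∀ k → R (g (inject₁ k)) (g (suc k))) → R (g (fromℕ n)) y →
                    Linked R (tabulate g ∷ʳ y)
  Linked-tabulate {zero}  g y next last = last ∷ [-]
  Linked-tabulate {suc n} g y next last =
    next zero ∷ Linked-tabulate (g ∘ suc) y (next ∘ suc) last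

  Linked-lookup : ∀ xs {y} → Linked R (xs ∷ʳ y) →
                  ∀ i j → suc (toℕ i) ≡ toℕ j → R (lookup xs i) (lookup xs j)
  Linked-lookup (x ∷ x′ ∷ xs) (r ∷ l) zero    (suc zero) _ = r
  Linked-lookup (x ∷ x′ ∷ xs) (r ∷ l) (suc i) (suc j)    e =
    Linked-lookup (x′ ∷ xs) l i j (ℕ.suc-injective e)

  Linked-lookup-last : ∀ xs {y} → Linked R (xs ∷ʳ y) →
                       ∀ i → suc (toℕ i) ≡ length xs → R (lookup xs i) y
  Linked-lookup-last (x ∷ [])      (r ∷ [-]) zero    _ = r
  Linked-lookup-last (x ∷ x′ ∷ xs) (r ∷ l)   (suc i) e =
    Linked-lookup-last (x′ ∷ xs) l i (ℕ.suc-injective e)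

Unique-lookup-injective : ∀ {A : Set} {xs : List A} → Unique xs →
                          ∀ {i j} → lookup xs i ≡ lookup xs j → i ≡ j
Unique-lookup-injective (x∉ ∷ u) {zero}  {zero}  _ = refl
Unique-lookup-injective (x∉ ∷ u) {zero}  {suc j} e = ⊥-elim (All.lookup x∉ (∈-lookup j) e)
Unique-lookup-injective (x∉ ∷ u) {suc i} {zero}  e = ⊥-elim (All.lookup x∉ (∈-lookup i) (sym e))
Unique-lookup-injective (x∉ ∷ u) {suc i} {suc j} e = cong suc (Unique-lookup-injective u e)

-- Walks and paths

module _ (G : Graph) where

  Adj-sym : ∀ {x y} → Adj G x y → Adj G y x
  Adj-sym {x} {y} xy = trans (E-sym G y x) xy

  Adj-irrefl : ∀ {x} → ¬ Adj G x x
  Adj-irrefl {x} xx with trans (sym (E-irr G x)) xx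
  ... | ()

  module _ {I : V G → Set} where

    Reach-head : ∀ {x y} → Reach G I x y → I x
    Reach-head (here ix)     = ix
    Reach-head (step ix _ _) = ix

    Reach-++ : ∀ {x y z} → Reach G I x y → Reach G I y z → Reach G I x z
    Reach-++ (here _)        r = r
    Reach-++ (step ix xy r₁) r = step ix xy (Reach-++ r₁ r)

    Reach-reverse : ∀ {x y} → Reach G I x y → Reach G I y x
    Reach-reverse (here ix)       = here ix
    Reach-reverse (step ix xy r) =
      Reach-++ (Reach-reverse r) (step (Reach-head r) (Adj-sym xy) (here ix))

  Reach-map : ∀ {I J : V G → Set} → (∀ {z} → I z → J z) → ∀ {x y} → Reach G I x y → Reach G J x y
  Reach-map f (here ix)      = here (f ix)
  Reach-map f (step ix xy r) = step (f ix) xy (Reach-map f r)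

-- Only the interior of the path is constrained by I and required to be repetition-free.
record Path (G : Graph) (I : V G → Set) (p q : V G) : Set where
  field
    inner  : List (V G)
    inside : All I inner
    unique : Unique inner
    linked : Linked (Adj G) (p ∷ inner ∷ʳ q)

  vertices : List (V G)
  vertices = p ∷ inner ∷ʳ q

-- Loop erasure: the walk is shortened at every repeated vertex.
Reach⇒Path : ∀ (G : Graph) {I : V G → Set} {p y z q} →
             Adj G p y → Reach G I y z → Adj G z q → Path G I p q
Reach⇒Path G {y = y} py (here iy) zq =
  record { inner = y ∷ [] ; inside = iy ∷ [] ; unique = [] ∷ [] ; linked = py ∷ zq ∷ [-] }
Reach⇒Path G {y = y} {q = q} py (step iy yy′ r) zq with Reach⇒Path G yy′ r zq
... | record { inner = Q ; inside = iQ ; unique = uQ ; linked = lQ } with y ∈? Q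
  where open DecMembership (_≟_ G) using (_∈?_)
... | no y∉Q = record
  { inner = y ∷ Q ; inside = iy ∷ iQ ; unique = Unique-∷ y∉Q uQ ; linked = py ∷ lQ }
... | yes y∈Q with ∈-∃++ y∈Q
... | A , B , refl = record
  { inner  = y ∷ B
  ; inside = All.++⁻ʳ A iQ
  ; unique = proj₁ (proj₂ (Unique-++⁻ A uQ))
  ; linked = py ∷ Linked-++⁻ʳ (y ∷ A)
                    (subst (Linked (Adj G)) (cong (y ∷_) (++-assoc A (y ∷ B) (q ∷ []))) lQ) }

Path-mono : ∀ {G : Graph} {I J : V G → Set} {p q} → (∀ {z} → I z → J z) → Path G I p q → Path G J p q
Path-mono I⇒J P = record { inner = inner ; inside = All.map I⇒J inside ; unique = unique ; linked = linked }
  where open Path P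

-- Propellers

record TwoNeighbours (G : Graph) (x : V G) (L : List (V G)) : Set where
  field
    nb₁ nb₂   : V G
    nb₁∈      : nb₁ ∈ L
    nb₂∈      : nb₂ ∈ L
    distinct  : nb₁ ≢ nb₂
    adj₁      : Adj G x nb₁
    adj₂      : Adj G x nb₂

TwoNeighbours-restrict : ∀ {G x L L′} → (∀ {y} → y ∈ L → Adj G x y → y ∈ L′) →
                         TwoNeighbours G x L → TwoNeighbours G x L′
TwoNeighbours-restrict keep n = record
  { nb₁ = nb₁ ; nb₂ = nb₂ ; nb₁∈ = keep nb₁∈ adj₁ ; nb₂∈ = keep nb₂∈ adj₂
  ; distinct = distinct ; adj₁ = adj₁ ; adj₂ = adj₂ }
  where open TwoNeighbours n

TwoNeighbours-both : ∀ {G x L a b} → (∀ {y} → y ∈ L → Adj G x y → y ≡ a ⊎ y ≡ b) →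
                     TwoNeighbours G x L → (a ∈ L × Adj G x a) × (b ∈ L × Adj G x b)
TwoNeighbours-both among
  record { nb₁∈ = nb₁∈ ; nb₂∈ = nb₂∈ ; distinct = distinct ; adj₁ = adj₁ ; adj₂ = adj₂ }
  with among nb₁∈ adj₁ | among nb₂∈ adj₂
... | inj₁ refl | inj₁ refl = ⊥-elim (distinct refl)
... | inj₁ refl | inj₂ refl = (nb₁∈ , adj₁) , (nb₂∈ , adj₂)
... | inj₂ refl | inj₁ refl = (nb₂∈ , adj₂) , (nb₁∈ , adj₁)
... | inj₂ refl | inj₂ refl = ⊥-elim (distinct refl)

-- Chords of the rim are allowed: ContainsPropeller only asks for a propeller subgraph.
record Propeller (G : Graph) (c : V G) : Set where
  field
    rest    : List (V G)
    unique  : Unique (c ∷ rest)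
    linked  : Linked (Adj G) (c ∷ rest ∷ʳ c)
    long    : 2 ≤ length rest
    centre  : V G
    centre∉ : centre ∉ c ∷ rest
    spokes  : TwoNeighbours G centre (c ∷ rest)

  rim : List (V G)
  rim = c ∷ rest

∃Propeller : Graph → Set
∃Propeller G = Σ (V G) (Propeller G)

Propeller-start∉rest : ∀ {G c} (P : Propeller G c) → c ∉ Propeller.rest P
Propeller-start∉rest P = Unique.Unique[x∷xs]⇒x∉xs (Propeller.unique P)

module _ {G : Graph} {p q M N} (P : Propeller G p) (eq : Propeller.rest P ≡ M ++ q ∷ N) where
  open Propeller P

  Propeller-arcs : Linked (Adj G) (p ∷ M ∷ʳ q) × Linked (Adj G) (q ∷ N ∷ʳ p)
  Propeller-arcs = Linked-split (p ∷ M)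
    (subst (Linked (Adj G)) (cong (p ∷_) (trans (cong (_∷ʳ p) eq) (++-assoc M (q ∷ N) (p ∷ [])))) linked)

  Propeller-arcs-avoid : All (¬_ ∘ Pair G p q) M × All (¬_ ∘ Pair G p q) N
  Propeller-arcs-avoid with subst (Unique ∘ (p ∷_)) eq unique
  ... | p∉ ∷ u′ with Unique-++⁻ M u′
  ... | _ , q∉N ∷ _ , disjoint =
    All.tabulate (λ { z∈ (inj₁ refl) → All.lookup p∉ (∈-++⁺ˡ z∈) refl
                    ; z∈ (inj₂ refl) → disjoint (z∈ , here refl) }) ,
    All.tabulate (λ { z∈ (inj₁ refl) → All.lookup p∉ (∈-++⁺ʳ M (there z∈)) refl
                    ; z∈ (inj₂ refl) → All.lookup q∉N z∈ refl })

Propeller-rotateAt : ∀ {G c} xs y ys (P : Propeller G c) → Propeller.rest P ≡ xs ++ y ∷ ys →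
                     Σ (Propeller G y) λ P′ → Propeller.rest P′ ≡ ys ++ c ∷ xs
Propeller-rotateAt {G} {c} xs y ys P eq = record
  { rest    = ys ++ c ∷ xs
  ; unique  = Unique-++-comm (c ∷ xs) (subst (Unique ∘ (c ∷_)) eq unique)
  ; linked  = Linked-rotate c xs y ys (subst (λ R → Linked (Adj G) (c ∷ R ∷ʳ c)) eq linked)
  ; long    = subst (2 ≤_) (trans (cong length eq)
                (ℕ.suc-injective (↭.↭-length (↭.++-comm (c ∷ xs) (y ∷ ys))))) long
  ; centre  = centre
  ; centre∉ = centre∉ ∘ to-rim ∘ Any.++-comm (y ∷ ys) (c ∷ xs)
  ; spokes  = TwoNeighbours-restrict (λ z∈ _ → Any.++-comm (c ∷ xs) (y ∷ ys) (from-rim z∈)) spokes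
  } , refl
  where
  open Propeller P
  to-rim : ∀ {z} → z ∈ c ∷ xs ++ y ∷ ys → z ∈ rim
  to-rim = subst (λ R → _ ∈ c ∷ R) (sym eq)
  from-rim : ∀ {z} → z ∈ rim → z ∈ c ∷ xs ++ y ∷ ys
  from-rim = subst (λ R → _ ∈ c ∷ R) eq

Propeller-rotate : ∀ {G c y} (P : Propeller G c) → y ∈ Propeller.rim P →
                   Σ (Propeller G y) λ P′ → Propeller.rim P′ ⊆ Propeller.rim P
Propeller-rotate P (here refl) = P , λ y∈ → y∈
Propeller-rotate {c = c} {y} P (there y∈) with ∈-∃++ y∈
... | xs , ys , eq with Propeller-rotateAt xs y ys P eq
... | P′ , eq′ = P′ , λ {z} z∈ →
  subst (λ L → z ∈ c ∷ L) (sym eq)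
    (Any.++-comm (y ∷ ys) (c ∷ xs) (subst (λ L → z ∈ y ∷ L) eq′ z∈))

Propeller-ends : ∀ {G c} (P : Propeller G c) →
  Σ (V G) λ d → Σ (List (V G)) λ T → Σ (V G) λ e →
    Propeller.rest P ≡ d ∷ T ∷ʳ e × d ≢ e × Adj G c d × Adj G c e
Propeller-ends {G} {c} P with Propeller.rest P in eq | Propeller.long P
... | d ∷ T′ | long with initLast T′
... | [] with long
...   | s≤s ()
Propeller-ends {G} {c} P | d ∷ _ | _ | T ∷ʳ′ e with subst (Unique ∘ (c ∷_)) eq (Propeller.unique P)
... | _ ∷ d∉ ∷ _ =
  d , T , e , refl , All.lookup d∉ (∈-++⁺ʳ T (here refl)) ,
  Linked.head (proj₁ arcs) , Adj-sym G (Linked.head (proj₂ arcs))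
  where
  arcs : Linked (Adj G) (c ∷ d ∷ T ∷ʳ e) × Linked (Adj G) (e ∷ [] ∷ʳ c)
  arcs = Propeller-arcs {M = d ∷ T} {N = []} P eq

Propeller-rimNeighbours : ∀ {G c y} (P : Propeller G c) → y ∈ Propeller.rim P →
                          TwoNeighbours G y (Propeller.rim P)
Propeller-rimNeighbours P y∈ with Propeller-rotate P y∈
... | P′ , P′⊆P with Propeller-ends P′
... | d , T , e , eq , d≢e , yd , ye = record
  { nb₁ = d ; nb₂ = e
  ; nb₁∈ = P′⊆P (subst (λ L → d ∈ _ ∷ L) (sym eq) (there (here refl)))
  ; nb₂∈ = P′⊆P (subst (λ L → e ∈ _ ∷ L) (sym eq) (there (there (∈-++⁺ʳ T (here refl)))))
  ; distinct = d≢e ; adj₁ = yd ; adj₂ = ye }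

record EmbeddingOn (G H : Graph) (S : V G → Set) (φ : V G → V H) : Set where
  field
    injective : ∀ {a b} → S a → S b → φ a ≡ φ b → a ≡ b
    adjacent  : ∀ {a b} → S a → S b → Adj G a b → Adj H (φ a) (φ b)

module _ {G H : Graph} {S : V G → Set} {φ : V G → V H} (emb : EmbeddingOn G H S φ) where
  open EmbeddingOn emb

  ∉-mapOn : ∀ {x L} → S x → All S L → x ∉ L → φ x ∉ map φ L
  ∉-mapOn sx sL x∉ φx∈ with ∈-map⁻ φ φx∈
  ... | y , y∈ , eq = x∉ (subst (_∈ _) (injective (All.lookup sL y∈) sx (sym eq)) y∈)

  TwoNeighbours-map : ∀ {x L} → S x → All S L → TwoNeighbours G x L → TwoNeighbours H (φ x) (map φ L)
  TwoNeighbours-map sx sL n = record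
    { nb₁ = φ nb₁ ; nb₂ = φ nb₂ ; nb₁∈ = ∈-map⁺ φ nb₁∈ ; nb₂∈ = ∈-map⁺ φ nb₂∈
    ; distinct = distinct ∘ injective (All.lookup sL nb₁∈) (All.lookup sL nb₂∈)
    ; adj₁ = adjacent sx (All.lookup sL nb₁∈) adj₁
    ; adj₂ = adjacent sx (All.lookup sL nb₂∈) adj₂ }
    where open TwoNeighbours n

  Propeller-map : ∀ {c} (P : Propeller G c) → All S (Propeller.rim P) → S (Propeller.centre P) →
                  Propeller H (φ c)
  Propeller-map {c} P sRim sCentre = record
    { rest    = map φ rest
    ; unique  = Unique-mapOn φ injective sRim unique
    ; linked  = subst (Linked (Adj H)) (map-++ φ (c ∷ rest) (c ∷ []))
                  (Linked-mapOn φ adjacent (All.∷ʳ⁺ sRim (All.head sRim)) linked)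
    ; long    = subst (2 ≤_) (sym (length-map φ rest)) long
    ; centre  = φ centre
    ; centre∉ = ∉-mapOn sCentre sRim centre∉
    ; spokes  = TwoNeighbours-map sCentre sRim spokes }
    where open Propeller P

dec-true⁻ : ∀ {A : Set} (a? : Dec A) → does a? ≡ true → A
dec-true⁻ (yes a) _ = a

module _ (m : ℕ) where

  private
    Rim : Set
    Rim = Fin (suc (suc (suc m)))

  cycNext? : (i j : Rim) → Dec (CycNext m i j)
  cycNext? i j = (suc (toℕ i) ℕ.≟ toℕ j) ⊎-dec ((toℕ i ℕ.≟ suc (suc m)) ×-dec (toℕ j ℕ.≟ 0))

  cycAdj? : (i j : Rim) → Dec (CycAdj m i j)
  cycAdj? i j = cycNext? i j ⊎-dec cycNext? j i

  CycAdj-irrefl : ∀ i → ¬ CycAdj m i i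
  CycAdj-irrefl i (inj₁ (inj₁ e))         = ℕ.1+n≢n e
  CycAdj-irrefl i (inj₂ (inj₁ e))         = ℕ.1+n≢n e
  CycAdj-irrefl i (inj₁ (inj₂ (e₁ , e₂))) with trans (sym e₁) e₂
  ... | ()
  CycAdj-irrefl i (inj₂ (inj₂ (e₁ , e₂))) with trans (sym e₁) e₂
  ... | ()

  -- The propeller with rim 0, 1, …, m+2 (in this cyclic order) and centre tt
  -- joined to the rim nodes i and j.
  modelPropeller : Rim → Rim → Graph
  modelPropeller i j = record
    { V = Rim ⊎ ⊤ ; _≟_ = ≡-dec Fin._≟_ Unit._≟_ ; E = edge ; E-sym = edge-sym ; E-irr = edge-irr }
    where
    spoke : Rim → Bool
    spoke k = does (k Fin.≟ i ⊎-dec k Fin.≟ j)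
    edge : Rim ⊎ ⊤ → Rim ⊎ ⊤ → Bool
    edge (inj₁ k) (inj₁ l) = does (cycAdj? k l)
    edge (inj₁ k) (inj₂ _) = spoke k
    edge (inj₂ _) (inj₁ l) = spoke l
    edge (inj₂ _) (inj₂ _) = false
    edge-sym : ∀ x y → edge x y ≡ edge y x
    edge-sym (inj₁ k) (inj₁ l) = ∨-comm (does (cycNext? k l)) (does (cycNext? l k))
    edge-sym (inj₁ _) (inj₂ _) = refl
    edge-sym (inj₂ _) (inj₁ _) = refl
    edge-sym (inj₂ _) (inj₂ _) = refl
    edge-irr : ∀ x → edge x x ≡ false
    edge-irr (inj₁ k) = dec-false (cycAdj? k k) (CycAdj-irrefl k)
    edge-irr (inj₂ _) = refl

  modelPropeller-isPropeller : ∀ {i j} → i ≢ j → IsPropeller (modelPropeller i j)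
  modelPropeller-isPropeller {i} {j} i≢j =
    m , inj₁ , inj₂ tt , (λ { refl → refl }) , (λ _ ()) , onRim ,
    (λ k l kl → dec-true⁻ (cycAdj? k l) kl) , (λ k l kl → dec-true (cycAdj? k l) kl) ,
    i , j , i≢j , dec-true (i Fin.≟ i ⊎-dec i Fin.≟ j) (inj₁ refl) ,
                  dec-true (j Fin.≟ i ⊎-dec j Fin.≟ j) (inj₂ refl)
    where
    onRim : ∀ y → y ≢ inj₂ tt → Σ Rim λ k → inj₁ k ≡ y
    onRim (inj₁ k) _   = k , refl
    onRim (inj₂ _) y≢c = ⊥-elim (y≢c refl)

∃Propeller⇒ContainsPropeller : ∀ {G} → ∃Propeller G → ContainsPropeller G
∃Propeller⇒ContainsPropeller (_ , record { rest = [] ; long = () })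
∃Propeller⇒ContainsPropeller (_ , record { rest = _ ∷ [] ; long = s≤s () })
∃Propeller⇒ContainsPropeller {G} (c , P@record { rest = t₁ ∷ t₂ ∷ T }) =
  modelPropeller m i j , modelPropeller-isPropeller m (distinct ∘ index-injective) ,
  φ , φ-injective , φ-adjacent
  where
  open Propeller P
  open TwoNeighbours spokes
  m : ℕ
  m = length T
  i j : Fin (suc (suc (suc m)))
  i = index nb₁∈
  j = index nb₂∈
  index-injective : i ≡ j → nb₁ ≡ nb₂
  index-injective i≡j =
    trans (Any.lookup-index nb₁∈) (trans (cong (lookup rim) i≡j) (sym (Any.lookup-index nb₂∈)))
  φ : Fin (suc (suc (suc m))) ⊎ ⊤ → V G
  φ (inj₁ k) = lookup rim k
  φ (inj₂ _) = centre
  φ-injective : ∀ {x y} → φ x ≡ φ y → x ≡ y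
  φ-injective {inj₁ k} {inj₁ l} e = cong inj₁ (Unique-lookup-injective unique e)
  φ-injective {inj₁ k} {inj₂ _} e = ⊥-elim (centre∉ (subst (_∈ rim) e (∈-lookup k)))
  φ-injective {inj₂ _} {inj₁ l} e = ⊥-elim (centre∉ (subst (_∈ rim) (sym e) (∈-lookup l)))
  φ-injective {inj₂ _} {inj₂ _} _ = refl
  rimEdge : ∀ k l → CycNext m k l → Adj G (lookup rim k) (lookup rim l)
  rimEdge k l            (inj₁ e)       = Linked-lookup rim linked k l e
  rimEdge k Fin.zero     (inj₂ (e , _)) = Linked-lookup-last rim linked k (cong suc e)
  spokeEdge : ∀ k → does (k Fin.≟ i ⊎-dec k Fin.≟ j) ≡ true → Adj G centre (lookup rim k)
  spokeEdge k e with dec-true⁻ (k Fin.≟ i ⊎-dec k Fin.≟ j) e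
  ... | inj₁ refl = subst (Adj G centre) (Any.lookup-index nb₁∈) adj₁
  ... | inj₂ refl = subst (Adj G centre) (Any.lookup-index nb₂∈) adj₂
  φ-adjacent : ∀ x y → Adj (modelPropeller m i j) x y → Adj G (φ x) (φ y)
  φ-adjacent (inj₁ k) (inj₁ l) e with dec-true⁻ (cycAdj? m k l) e
  ... | inj₁ kl = rimEdge k l kl
  ... | inj₂ lk = Adj-sym G (rimEdge l k lk)
  φ-adjacent (inj₁ k) (inj₂ _) e = Adj-sym G (spokeEdge k e)
  φ-adjacent (inj₂ _) (inj₁ l) e = spokeEdge l e

ContainsPropeller⇒∃Propeller : ∀ {G} → ContainsPropeller G → ∃Propeller G
ContainsPropeller⇒∃Propeller {G}
  (H , (m , f , x , f-inj , f≢x , _ , _ , c2a , i , j , i≢j , xi , xj) , φ , φ-inj , φ-adj) =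
  g Fin.zero , record
    { rest    = tabulate (g ∘ Fin.suc)
    ; unique  = Unique.tabulate⁺ {f = g} (f-inj ∘ φ-inj)
    ; linked  = Linked-tabulate g (g Fin.zero) next last
    ; long    = subst (2 ≤_) (sym (length-tabulate (g ∘ Fin.suc))) (s≤s (s≤s z≤n))
    ; centre  = φ x
    ; centre∉ = λ x∈ → let k , e = ∈-tabulate⁻ {f = g} x∈ in f≢x k (sym (φ-inj e))
    ; spokes  = record
      { nb₁ = g i ; nb₂ = g j ; nb₁∈ = ∈-tabulate⁺ {f = g} i ; nb₂∈ = ∈-tabulate⁺ {f = g} j
      ; distinct = i≢j ∘ f-inj ∘ φ-inj ; adj₁ = φ-adj _ _ xi ; adj₂ = φ-adj _ _ xj } }
  where
  g : Fin (suc (suc (suc m))) → V G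
  g = φ ∘ f
  next : ∀ k → Adj G (g (inject₁ k)) (g (Fin.suc k))
  next k = φ-adj _ _ (c2a (inject₁ k) (Fin.suc k) (inj₁ (inj₁ (cong suc (toℕ-inject₁ k)))))
  last : Adj G (g (fromℕ (suc (suc m)))) (g Fin.zero)
  last = φ-adj _ _ (c2a (fromℕ (suc (suc m))) Fin.zero (inj₁ (inj₂ (toℕ-fromℕ (suc (suc m)) , refl))))

-- Fans

record Fan (G : Graph) (I : V G → Set) (p q : V G) : Set where
  field
    path    : Path G I p q
    centre  : V G
    centre∉ : centre ∉ Path.vertices path
    spokes  : TwoNeighbours G centre (Path.vertices path)
  open Path path public

Propeller⇒Fan : ∀ {G I p q M N} (P : Propeller G p) → Propeller.rest P ≡ M ++ q ∷ N → All I M →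
                (∀ {z} → z ∈ N → ¬ Adj G (Propeller.centre P) z) → Fan G I p q
Propeller⇒Fan {G} {p = p} {q} {M} {N} P eq iM blind = record
  { path    = record { inner = M ; inside = iM ; unique = proj₁ (Unique-++⁻ M (Unique.tail unique′))
                     ; linked = proj₁ (Propeller-arcs P eq) }
  ; centre  = centre
  ; centre∉ = centre∉ ∘ onRim
  ; spokes  = TwoNeighbours-restrict onArc spokes }
  where
  open Propeller P
  unique′ : Unique (p ∷ M ++ q ∷ N)
  unique′ = subst (Unique ∘ (p ∷_)) eq unique
  onRim : ∀ {z} → z ∈ p ∷ M ∷ʳ q → z ∈ rim
  onRim z∈ with ∈-++⁻ (p ∷ M) z∈
  ... | inj₁ z∈pM        = subst (λ R → _ ∈ p ∷ R) (sym eq) (∈-++⁺ˡ z∈pM)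
  ... | inj₂ (here refl) = subst (λ R → _ ∈ p ∷ R) (sym eq) (∈-++⁺ʳ (p ∷ M) (here refl))
  onArc : ∀ {z} → z ∈ rim → Adj G centre z → z ∈ p ∷ M ∷ʳ q
  onArc z∈ cz with ∈-++⁻ (p ∷ M) (subst (λ R → _ ∈ p ∷ R) eq z∈)
  ... | inj₁ z∈pM        = ∈-++⁺ˡ z∈pM
  ... | inj₂ (here refl) = ∈-++⁺ʳ (p ∷ M) (here refl)
  ... | inj₂ (there z∈N) = ⊥-elim (blind z∈N cz)

Fan-map : ∀ {G H S φ I J p q} → EmbeddingOn G H S φ → (F : Fan G I p q) →
          All S (Fan.vertices F) → S (Fan.centre F) → All (J ∘ φ) (Fan.inner F) → Fan H J (φ p) (φ q)
Fan-map {H = H} {φ = φ} {p = p} {q} emb F sV sCentre jInner = record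
  { path    = record
    { inner  = map φ inner
    ; inside = All.map⁺ jInner
    ; unique = Unique-mapOn φ injective (All.++⁻ˡ inner (All.tail sV)) unique
    ; linked = subst (Linked (Adj H)) map-vertices (Linked-mapOn φ adjacent sV linked) }
  ; centre  = φ centre
  ; centre∉ = subst (φ centre ∉_) map-vertices (∉-mapOn emb sCentre sV centre∉)
  ; spokes  = subst (TwoNeighbours H (φ centre)) map-vertices (TwoNeighbours-map emb sCentre sV spokes) }
  where
  open EmbeddingOn emb
  open Fan F
  map-vertices : map φ vertices ≡ φ p ∷ map φ inner ∷ʳ φ q
  map-vertices = cong (φ p ∷_) (map-++ φ inner (q ∷ []))

Fan+Path⇒Propeller : ∀ {G I J p q} → p ≢ q → ¬ Adj G p q →
  (∀ {z} → I z → ¬ Pair G p q z) → (∀ {z} → J z → ¬ Pair G p q z) → (∀ {z} → I z → ¬ J z) →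
  (F : Fan G I p q) → ¬ J (Fan.centre F) → Path G J q p → Propeller G p
Fan+Path⇒Propeller {G} {p = p} {q} p≢q ¬pq I-inner J-inner I⊥J F ¬Jc Q = record
  { rest    = M ++ q ∷ N
  ; unique  = Unique.++⁺ (Unique-∷ p∉M uM) (Unique-∷ q∉N uN) disjoint
  ; linked  = subst (Linked (Adj G)) (cong (p ∷_) (sym (++-assoc M (q ∷ N) (p ∷ []))))
                (Linked-join (p ∷ M) linked (Path.linked Q))
  ; long    = long M N linked
  ; centre  = centre
  ; centre∉ = λ c∈ → case-centre (∈-++⁻ (p ∷ M) c∈)
  ; spokes  = TwoNeighbours-restrict (λ z∈ _ → widen z∈) spokes }
  where
  open Fan F renaming (inner to M; unique to uM; inside to iM)
  open Path Q using () renaming (inner to N; unique to uN; inside to iN)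
  p∉M : p ∉ M
  p∉M p∈ = I-inner (All.lookup iM p∈) (inj₁ refl)
  q∉N : q ∉ N
  q∉N q∈ = J-inner (All.lookup iN q∈) (inj₂ refl)
  disjoint : ∀ {z} → ¬ (z ∈ p ∷ M × z ∈ q ∷ N)
  disjoint (here refl , here z≡q)  = p≢q z≡q
  disjoint (here refl , there z∈N) = J-inner (All.lookup iN z∈N) (inj₁ refl)
  disjoint (there z∈M , here refl) = I-inner (All.lookup iM z∈M) (inj₂ refl)
  disjoint (there z∈M , there z∈N) = I⊥J (All.lookup iM z∈M) (All.lookup iN z∈N)
  long : ∀ A B → Linked (Adj G) (p ∷ A ∷ʳ q) → 2 ≤ length (A ++ q ∷ B)
  long []      []      (pq ∷ _) = ⊥-elim (¬pq pq)
  long []      (_ ∷ _) _        = s≤s (s≤s z≤n)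
  long (_ ∷ A) _       _        = s≤s (∈-length (∈-++⁺ʳ A (here refl)))
  widen : ∀ {z} → z ∈ (p ∷ M) ∷ʳ q → z ∈ (p ∷ M) ++ q ∷ N
  widen z∈ with ∈-++⁻ (p ∷ M) z∈
  ... | inj₁ z∈pM        = ∈-++⁺ˡ z∈pM
  ... | inj₂ (here refl) = ∈-++⁺ʳ (p ∷ M) (here refl)
  case-centre : centre ∈ p ∷ M ⊎ centre ∈ q ∷ N → ⊥
  case-centre (inj₁ c∈)          = centre∉ (∈-++⁺ˡ c∈)
  case-centre (inj₂ (here refl)) = centre∉ (∈-++⁺ʳ (p ∷ M) (here refl))
  case-centre (inj₂ (there c∈N)) = ¬Jc (All.lookup iN c∈N)

Fan-atEnds : ∀ {G I p q x} (P : Path G I p q) → x ∉ Path.vertices P → p ≢ q →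
             Adj G x p → Adj G x q → Fan G I p q
Fan-atEnds P x∉ p≢q xp xq = record
  { path = P ; centre = _ ; centre∉ = x∉
  ; spokes = record { nb₁∈ = here refl ; nb₂∈ = there (∈-++⁺ʳ (Path.inner P) (here refl))
                    ; distinct = p≢q ; adj₁ = xp ; adj₂ = xq } }

Fan-cast : ∀ {G I p q p′ q′} → p ≡ p′ → q ≡ q′ → Fan G I p q → Fan G I p′ q′
Fan-cast {G} p≡ q≡ F = record
  { path    = record { inner = inner ; inside = inside ; unique = unique
                     ; linked = subst₂ (λ a b → Linked (Adj G) (a ∷ inner ∷ʳ b)) p≡ q≡ linked }
  ; centre  = centre
  ; centre∉ = subst₂ (λ a b → centre ∉ a ∷ inner ∷ʳ b) p≡ q≡ centre∉
  ; spokes  = subst₂ (λ a b → TwoNeighbours G centre (a ∷ inner ∷ʳ b)) p≡ q≡ spokes }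
  where open Fan F

-- The two sides of the cutset

⌊⌋-true⁻ : ∀ {A : Set} (a? : Dec A) → ⌊ a? ⌋ ≡ true → A
⌊⌋-true⁻ (yes a) _ = a

⌊⌋-true : ∀ {A : Set} (a? : Dec A) → A → ⌊ a? ⌋ ≡ true
⌊⌋-true (yes _) _ = refl
⌊⌋-true (no ¬a) a = ⊥-elim (¬a a)

Split-swap : ∀ {G u v} → Split G u v → Split G u v
Split-swap {G} s = record
  { C₁ = C₂ s ; C₂ = C₁ s ; out₁ = out₂ s ; out₂ = out₁ s
  ; cover = λ x ¬pr → Sum.swap (cover s x ¬pr)
  ; disj = λ x in₂ in₁ → disj s x in₁ in₂ ; ne₁ = ne₂ s ; ne₂ = ne₁ s
  ; no-edge = λ x y in₂ in₁ xy → no-edge s y x in₁ in₂ (Adj-sym G xy) }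

data Ends (G : Graph) (u v : V G) : V G → V G → Set where
  uv : Ends G u v u v
  vu : Ends G u v v u

module _ {G : Graph} {u v : V G} where

  Ends-flip : ∀ {p q} → Ends G u v p q → Ends G u v q p
  Ends-flip uv = vu
  Ends-flip vu = uv

  Ends-flip-involutive : ∀ {p q} (e : Ends G u v p q) → Ends-flip (Ends-flip e) ≡ e
  Ends-flip-involutive uv = refl
  Ends-flip-involutive vu = refl

  Ends-pair : ∀ {p q z} → Ends G u v p q → Pair G u v z → Pair G p q z
  Ends-pair uv = λ z → z
  Ends-pair vu = Sum.swap

  Ends-pair⁻ : ∀ {p q z} → Ends G u v p q → Pair G p q z → Pair G u v z
  Ends-pair⁻ uv = λ z → z
  Ends-pair⁻ vu = Sum.swap

module Side (G : Graph) {u v : V G} (u≢v : u ≢ v) (¬uv : ¬ Adj G u v) (s : Split G u v) where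

  In₁ In₂ InW : V G → Set
  In₁ z = C₁ s z ≡ true
  In₂ z = C₂ s z ≡ true
  InW z = T (WithPair G (C₁ s) u v z)

  Ends-≢ : ∀ {p q} → Ends G u v p q → p ≢ q
  Ends-≢ uv = u≢v
  Ends-≢ vu = u≢v ∘ sym

  Ends-¬adj : ∀ {p q} → Ends G u v p q → ¬ Adj G p q
  Ends-¬adj uv = ¬uv
  Ends-¬adj vu = ¬uv ∘ Adj-sym G

  In₁⇒¬Pair : ∀ {z} → In₁ z → ¬ Pair G u v z
  In₁⇒¬Pair = out₁ s _

  In₁⇒¬In₂ : ∀ {z} → In₁ z → ¬ In₂ z
  In₁⇒¬In₂ = disj s _

  InW-intro : ∀ {z} → In₁ z ⊎ Pair G u v z → InW z
  InW-intro {z} c with C₁ s z | _≟_ G z u | _≟_ G z v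
  ... | true  | _       | _       = tt
  ... | false | yes _   | _       = tt
  ... | false | no _    | yes _   = tt
  InW-intro (inj₂ (inj₁ z≡u)) | false | no z≢u | no _ = z≢u z≡u
  InW-intro (inj₂ (inj₂ z≡v)) | false | no _ | no z≢v = z≢v z≡v

  InW-elim : ∀ {z} → InW z → In₁ z ⊎ Pair G u v z
  InW-elim {z} w with C₁ s z | _≟_ G z u | _≟_ G z v
  ... | true  | _       | _       = inj₁ refl
  ... | false | yes z≡u | _       = inj₂ (inj₁ z≡u)
  ... | false | no _    | yes z≡v = inj₂ (inj₂ z≡v)

  InW⇒¬In₂ : ∀ {z} → InW z → ¬ In₂ z
  InW⇒¬In₂ w c₂ with InW-elim w
  ... | inj₁ c₁ = In₁⇒¬In₂ c₁ c₂
  ... | inj₂ pr = out₂ s _ c₂ pr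

  In₁-step : ∀ {y z} → In₁ y → Adj G y z → ¬ Pair G u v z → In₁ z
  In₁-step {y} {z} c yz ¬pr with cover s z ¬pr
  ... | inj₁ c₁ = c₁
  ... | inj₂ c₂ = ⊥-elim (no-edge s y z c c₂ yz)

  Linked-In₁ : ∀ {y L} → In₁ y → Linked (Adj G) (y ∷ L) → All (¬_ ∘ Pair G u v) L → All In₁ L
  Linked-In₁ c [-]       []           = []
  Linked-In₁ c (yz ∷ l)  (¬pr ∷ ¬prs) = In₁-step c yz ¬pr ∷ Linked-In₁ (In₁-step c yz ¬pr) l ¬prs

  G′ : Graph
  G′ = Glue G (C₁ s) u v

  u′ v′ : V G′
  u′ = inj₂ zero
  v′ = inj₂ (suc zero)

  Old : V G′ → Set
  Old (inj₁ _) = ⊤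
  Old (inj₂ _) = ⊥

  π : V G′ → V G
  π (inj₁ (z , _)) = z
  π (inj₂ _)       = u

  -- The vertices outside C₁ ∪ {u, v} are sent to the junk value u′.
  ι : V G → V G′
  ι z with T? (WithPair G (C₁ s) u v z)
  ... | yes w = inj₁ (z , w)
  ... | no _  = u′

  ι-InW : ∀ {z} (w : InW z) → ι z ≡ inj₁ (z , w)
  ι-InW {z} w with T? (WithPair G (C₁ s) u v z)
  ... | yes w′ = cong (λ t → inj₁ (z , t)) (T-irrelevant w′ w)
  ... | no ¬w  = ⊥-elim (¬w w)

  π-ι : ∀ {z} → InW z → π (ι z) ≡ z
  π-ι w = cong π (ι-InW w)

  Old-ι : ∀ {z} → InW z → Old (ι z)
  Old-ι w rewrite ι-InW w = tt

  π-InW : ∀ {w} → Old w → InW (π w)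
  π-InW {inj₁ (_ , w)} _ = w

  π-embedding : EmbeddingOn G′ G Old π
  π-embedding = record { injective = injective ; adjacent = adjacent }
    where
    injective : ∀ {a b} → Old a → Old b → π a ≡ π b → a ≡ b
    injective {inj₁ (z , w)} {inj₁ (.z , w′)} _ _ refl = cong (λ t → inj₁ (z , t)) (T-irrelevant w w′)
    adjacent : ∀ {a b} → Old a → Old b → Adj G′ a b → Adj G (π a) (π b)
    adjacent {inj₁ _} {inj₁ _} _ _ ab = ab

  Old⇒ι-π : ∀ {w} → Old w → w ≡ ι (π w)
  Old⇒ι-π {inj₁ (_ , w)} _ = sym (ι-InW w)

  In₁′ : V G′ → Set
  In₁′ w = Old w × In₁ (π w)

  In₁′-ι : ∀ {z} → In₁ z → In₁′ (ι z)
  In₁′-ι c = Old-ι (InW-intro (inj₁ c)) , subst In₁ (sym (π-ι (InW-intro (inj₁ c)))) c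

  ι-embedding : EmbeddingOn G G′ InW ι
  ι-embedding = record
    { injective = λ wa wb e → trans (sym (π-ι wa)) (trans (cong π e) (π-ι wb))
    ; adjacent  = λ wa wb ab → subst₂ (Adj G′) (sym (ι-InW wa)) (sym (ι-InW wb)) ab }

  marker : ∀ {p q} → Ends G u v p q → V G′
  marker uv = u′
  marker vu = v′

  marker-adj : ∀ {p q} (e : Ends G u v p q) → Adj G′ (marker e) (ι p)
  marker-adj uv =
    subst (Adj G′ u′) (sym (ι-InW (InW-intro (inj₂ (inj₁ refl))))) (⌊⌋-true (_≟_ G u u) refl)
  marker-adj vu =
    subst (Adj G′ v′) (sym (ι-InW (InW-intro (inj₂ (inj₂ refl))))) (⌊⌋-true (_≟_ G v v) refl)

  markers-adj : ∀ {p q} (e : Ends G u v p q) → Adj G′ (marker e) (marker (Ends-flip e))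
  markers-adj uv = refl
  markers-adj vu = refl

  marker-neighbours : ∀ {p q} (e : Ends G u v p q) w → Adj G′ (marker e) w →
                      w ≡ marker (Ends-flip e) ⊎ w ≡ ι p
  marker-neighbours uv (inj₁ (z , w)) e with ⌊⌋-true⁻ (_≟_ G z u) e
  ... | refl = inj₂ (sym (ι-InW w))
  marker-neighbours vu (inj₁ (z , w)) e with ⌊⌋-true⁻ (_≟_ G z v) e
  ... | refl = inj₂ (sym (ι-InW w))
  marker-neighbours uv (inj₂ zero)       ()
  marker-neighbours uv (inj₂ (suc zero)) _ = inj₁ refl
  marker-neighbours vu (inj₂ zero)       _ = inj₁ refl
  marker-neighbours vu (inj₂ (suc zero)) ()

  ¬Old-marker : ∀ {p q} (e : Ends G u v p q) → ¬ Old (marker e)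
  ¬Old-marker uv ()
  ¬Old-marker vu ()

  Old-unless-marker : ∀ {p q} (e : Ends G u v p q) {w} → w ≢ marker e → w ≢ marker (Ends-flip e) → Old w
  Old-unless-marker _  {inj₁ _}         _   _   = tt
  Old-unless-marker uv {inj₂ zero}      ≢u′ _   = ≢u′ refl
  Old-unless-marker uv {inj₂ (suc zero)} _  ≢v′ = ≢v′ refl
  Old-unless-marker vu {inj₂ zero}      _   ≢u′ = ≢u′ refl
  Old-unless-marker vu {inj₂ (suc zero)} ≢v′ _  = ≢v′ refl

  Ends-InW : ∀ {p q} → Ends G u v p q → InW p
  Ends-InW uv = InW-intro (inj₂ (inj₁ refl))
  Ends-InW vu = InW-intro (inj₂ (inj₂ refl))

  vertices-InW : ∀ {p q} → Ends G u v p q → (P : Path G In₁ p q) → All InW (Path.vertices P)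
  vertices-InW e P =
    Ends-InW e ∷ All.∷ʳ⁺ (All.map (InW-intro ∘ inj₁) (Path.inside P)) (Ends-InW (Ends-flip e))

  markerPath : ∀ {p q} (e : Ends G u v p q) → Path G′ (¬_ ∘ Old) (ι q) (ι p)
  markerPath uv = record
    { inner = v′ ∷ u′ ∷ [] ; inside = (λ ()) ∷ (λ ()) ∷ [] ; unique = ((λ ()) ∷ []) ∷ [] ∷ []
    ; linked = Adj-sym G′ {v′} {ι v} (marker-adj vu) ∷ markers-adj vu ∷ marker-adj uv ∷ [-] }
  markerPath vu = record
    { inner = u′ ∷ v′ ∷ [] ; inside = (λ ()) ∷ (λ ()) ∷ [] ; unique = ((λ ()) ∷ []) ∷ [] ∷ []
    ; linked = Adj-sym G′ {u′} {ι u} (marker-adj uv) ∷ markers-adj uv ∷ marker-adj vu ∷ [-] }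

  -- Closing the fan's path with u – u′ – v′ – v gives a propeller of G′.
  Fan⇒Propeller′ : ∀ {p q} → Ends G u v p q → (F : Fan G In₁ p q) → In₁ (Fan.centre F) →
                   ∃Propeller G′
  Fan⇒Propeller′ {p} {q} e F c∈C₁ =
    ι p , Fan+Path⇒Propeller ιp≢ιq ¬ιpιq old-inner marker-inner (λ (old , _) ¬old → ¬old old)
            F′ (λ ¬old → ¬old (Old-ι wc)) (markerPath e)
    where
    open Fan F
    wp : InW p
    wp = Ends-InW e
    wq : InW q
    wq = Ends-InW (Ends-flip e)
    wc : InW centre
    wc = InW-intro (inj₁ c∈C₁)
    F′ : Fan G′ In₁′ (ι p) (ι q)
    F′ = Fan-map ι-embedding F (vertices-InW e path) wc (All.map In₁′-ι inside)
    ιp≢ιq : ι p ≢ ι q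
    ιp≢ιq = Ends-≢ e ∘ EmbeddingOn.injective ι-embedding wp wq
    ¬ιpιq : ¬ Adj G′ (ι p) (ι q)
    ¬ιpιq a = Ends-¬adj e (subst₂ (Adj G) (π-ι wp) (π-ι wq)
                (EmbeddingOn.adjacent π-embedding (Old-ι wp) (Old-ι wq) a))
    old-inner : ∀ {w} → In₁′ w → ¬ Pair G′ (ι p) (ι q) w
    old-inner (_ , c) (inj₁ refl) = In₁⇒¬Pair (subst In₁ (π-ι wp) c) (Ends-pair⁻ e (inj₁ refl))
    old-inner (_ , c) (inj₂ refl) = In₁⇒¬Pair (subst In₁ (π-ι wq) c) (Ends-pair⁻ e (inj₂ refl))
    marker-inner : ∀ {w} → ¬ Old w → ¬ Pair G′ (ι p) (ι q) w
    marker-inner ¬old (inj₁ refl) = ¬old (Old-ι wp)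
    marker-inner ¬old (inj₂ refl) = ¬old (Old-ι wq)

  -- A walk from C₁ to q avoiding the other end p can only leave C₁ through q.
  Reach-exit : ∀ {p q y} {K : V G → Set} → Ends G u v p q → In₁ y →
               Reach G (λ z → ¬ (K z ⊎ z ≡ p)) y q →
               Σ (V G) λ z → Reach G (λ z → In₁ z × ¬ K z) y z × Adj G z q
  Reach-exit e c (here _) = ⊥-elim (In₁⇒¬Pair c (Ends-pair⁻ e (inj₂ refl)))
  Reach-exit {q = q} {y} e c (step {y = y′} ¬Ky yy′ r) with _≟_ G y′ q
  ... | yes refl = y , here (c , ¬Ky ∘ inj₁) , yy′
  ... | no y′≢q with Reach-exit e (In₁-step c yy′ ¬pair) r
    where
    ¬pair : ¬ Pair G u v y′
    ¬pair pr with Ends-pair e pr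
    ... | inj₁ y′≡p = Reach-head G r (inj₂ y′≡p)
    ... | inj₂ y′≡q = y′≢q y′≡q
  ... | z , R , zq = z , step (c , ¬Ky ∘ inj₁) yy′ R , zq

  Path-inside : ∀ {p q y} {K : V G → Set} → Ends G u v p q → In₁ y →
                Reach G (λ z → ¬ (K z ⊎ z ≡ p)) y q → Reach G (λ z → ¬ (K z ⊎ z ≡ q)) y p →
                Path G (λ z → In₁ z × ¬ K z) p q
  Path-inside e c toq top with Reach-exit e c toq | Reach-exit (Ends-flip e) c top
  ... | z₁ , R₁ , z₁q | z₂ , R₂ , z₂p =
    Reach⇒Path G (Adj-sym G z₂p) (Reach-++ G (Reach-reverse G R₂) R₁) z₁q

  sidePath : TwoConnected G → ∀ {p q} → Ends G u v p q → ¬ ¬ Path G In₁ p q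
  sidePath (_ , ¬cut) {p} {q} e k =
    avoid p q (Ends-pair⁻ e (inj₁ refl)) (Ends-≢ e ∘ sym) λ toq →
    avoid q p (Ends-pair⁻ e (inj₂ refl)) (Ends-≢ e) λ top →
    k (Path-mono proj₁ (Path-inside {K = λ _ → ⊥} e c (Reach-map G ¬⊥⊎ toq) (Reach-map G ¬⊥⊎ top)))
    where
    y : V G
    y = proj₁ (ne₁ s)
    c : In₁ y
    c = proj₂ (ne₁ s)
    ¬⊥⊎ : ∀ {a z} → ¬ z ≡ a → ¬ (⊥ ⊎ z ≡ a)
    ¬⊥⊎ z≢a (inj₂ z≡a) = z≢a z≡a
    avoid : ∀ a b → Pair G u v a → b ≢ a → ¬ ¬ Reach G (λ z → ¬ z ≡ a) y b
    avoid a b pa b≢a ¬r = ¬cut a (inj₁ (y , b , (λ { refl → In₁⇒¬Pair c pa }) , b≢a , ¬r))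

  sidePaths : TwoConnected G → ¬ ¬ (∀ {p q} → Ends G u v p q → Path G In₁ p q)
  sidePaths tc k = sidePath tc uv λ P-uv → sidePath tc vu λ P-vu → k λ { uv → P-uv ; vu → P-vu }

  private
    path-uxv : ∀ {x} → In₁ x → Adj G x u → Adj G x v → Path G In₁ u v
    path-uxv cx xu xv = record
      { inner = _ ∷ [] ; inside = cx ∷ [] ; unique = [] ∷ [] ; linked = Adj-sym G xu ∷ xv ∷ [-] }

    end∈uxv : ∀ {x p q} → Ends G u v p q → p ∈ u ∷ x ∷ v ∷ []
    end∈uxv uv = here refl
    end∈uxv vu = there (there (here refl))

  -- c is the centre of a fan on the path u x v.
  common-neighbour⇒Propeller′ : ∀ {x} → In₁ x → Adj G x u → Adj G x v →
    ∀ {p q} → Ends G u v p q → ∀ c → ¬ Pair G x p c → Adj G x c → Adj G p c → ∃Propeller G′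
  common-neighbour⇒Propeller′ {x} cx xu xv {p} e c c∉ xc pc =
    Fan⇒Propeller′ uv fan cc
    where
    cc : In₁ c
    cc = In₁-step cx xc λ pr → case (Ends-pair e pr)
      where
      case : c ≡ p ⊎ c ≡ _ → ⊥
      case (inj₁ c≡p)  = c∉ (inj₂ c≡p)
      case (inj₂ refl) = Ends-¬adj e pc
    fan : Fan G In₁ u v
    fan = record
      { path    = path-uxv cx xu xv
      ; centre  = c
      ; centre∉ = λ { (here refl) → In₁⇒¬Pair cc (inj₁ refl)
                    ; (there (here c≡x)) → c∉ (inj₁ c≡x)
                    ; (there (there (here refl))) → In₁⇒¬Pair cc (inj₂ refl) }
      ; spokes  = record
        { nb₁∈ = there (here refl) ; nb₂∈ = end∈uxv e
        ; distinct = λ { refl → In₁⇒¬Pair cx (Ends-pair⁻ e (inj₁ refl)) }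
        ; adj₁ = Adj-sym G xc ; adj₂ = Adj-sym G pc } }

  common-neighbour-alone : (∀ a b → ¬ ProperK2Cutset G a b) → ¬ ∃Propeller G′ →
    ∀ {x} → In₁ x → Adj G x u → Adj G x v → ∀ {y} → In₁ y → y ≡ x
  common-neighbour-alone noK2 ¬P′ {x} cx xu xv {y} cy with _≟_ G y x
  ... | yes y≡x = y≡x
  ... | no y≢x  = ⊥-elim (connected uv λ tov → connected vu λ tou →
                    ¬P′ (Fan⇒Propeller′ uv (fan (Path-inside uv cy tov tou)) cx))
    where
    x-end : ∀ {p q} → Ends G u v p q → Adj G x p
    x-end uv = xu
    x-end vu = xv
    x∉pair : ∀ {z} → Pair G u v z → x ≢ z
    x∉pair pr refl = In₁⇒¬Pair cx pr
    connected : ∀ {p q} → Ends G u v p q → ¬ ¬ Reach G (λ z → ¬ Pair G x p z) y q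
    connected {p} {q} e ¬r = noK2 x p
      ( (x-end e , y , q
        , (λ { (inj₁ y≡x) → y≢x y≡x ; (inj₂ refl) → In₁⇒¬Pair cy (Ends-pair⁻ e (inj₁ refl)) })
        , (λ { (inj₁ refl) → x∉pair (Ends-pair⁻ e (inj₂ refl)) refl
             ; (inj₂ q≡p) → Ends-≢ e (sym q≡p) })
        , ¬r)
      , λ c c∉ (xc , pc) → ¬P′ (common-neighbour⇒Propeller′ cx xu xv e c c∉ xc pc))
    fan : Path G (λ z → In₁ z × z ≢ x) u v → Fan G In₁ u v
    fan P = Fan-atEnds (Path-mono proj₁ P) x∉ u≢v xu xv
      where
      x∉ : x ∉ Path.vertices (Path-mono proj₁ P)
      x∉ (here refl) = x∉pair (inj₁ refl) refl
      x∉ (there x∈) with ∈-++⁻ (Path.inner P) x∈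
      ... | inj₁ x∈inner    = proj₂ (All.lookup (Path.inside P) x∈inner) refl
      ... | inj₂ (here refl) = x∉pair (inj₂ refl) refl

  uxv-chordless : ∀ {x} → In₁ x → Adj G x u → Adj G x v → (∀ {y} → In₁ y → y ≡ x) →
                  InducedChordlessPath G (WithPair G (C₁ s) u v) u v
  uxv-chordless {x} cx xu xv alone =
    2 , f , injective , refl , refl , (λ i → Equivalence.to T-≡ (inW i)) , onto , adj⇒next , next⇒adj
    where
    f : Fin 3 → V G
    f zero             = u
    f (suc zero)       = x
    f (suc (suc zero)) = v
    x≢u : x ≢ u
    x≢u x≡u = In₁⇒¬Pair cx (inj₁ x≡u)
    x≢v : x ≢ v
    x≢v x≡v = In₁⇒¬Pair cx (inj₂ x≡v)
    injective : ∀ {i j} → f i ≡ f j → i ≡ j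
    injective {zero}             {zero}             _ = refl
    injective {zero}             {suc zero}         e = ⊥-elim (x≢u (sym e))
    injective {zero}             {suc (suc zero)}   e = ⊥-elim (u≢v e)
    injective {suc zero}         {zero}             e = ⊥-elim (x≢u e)
    injective {suc zero}         {suc zero}         _ = refl
    injective {suc zero}         {suc (suc zero)}   e = ⊥-elim (x≢v e)
    injective {suc (suc zero)}   {zero}             e = ⊥-elim (u≢v (sym e))
    injective {suc (suc zero)}   {suc zero}         e = ⊥-elim (x≢v (sym e))
    injective {suc (suc zero)}   {suc (suc zero)}   _ = refl
    inW : ∀ i → InW (f i)
    inW zero             = InW-intro (inj₂ (inj₁ refl))
    inW (suc zero)       = InW-intro (inj₁ cx)
    inW (suc (suc zero)) = InW-intro (inj₂ (inj₂ refl))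
    onto : ∀ z → WithPair G (C₁ s) u v z ≡ true → Σ (Fin 3) λ i → f i ≡ z
    onto z w with InW-elim (Equivalence.from T-≡ w)
    ... | inj₁ cz          = suc zero , sym (alone cz)
    ... | inj₂ (inj₁ refl) = zero , refl
    ... | inj₂ (inj₂ refl) = suc (suc zero) , refl
    adj⇒next : ∀ i j → Adj G (f i) (f j) → ℕ.suc (toℕ i) ≡ toℕ j ⊎ ℕ.suc (toℕ j) ≡ toℕ i
    adj⇒next zero             (suc zero)       _ = inj₁ refl
    adj⇒next (suc zero)       zero             _ = inj₂ refl
    adj⇒next (suc zero)       (suc (suc zero)) _ = inj₁ refl
    adj⇒next (suc (suc zero)) (suc zero)       _ = inj₂ refl
    adj⇒next zero             zero             a = ⊥-elim (Adj-irrefl G a)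
    adj⇒next (suc zero)       (suc zero)       a = ⊥-elim (Adj-irrefl G a)
    adj⇒next (suc (suc zero)) (suc (suc zero)) a = ⊥-elim (Adj-irrefl G a)
    adj⇒next zero             (suc (suc zero)) a = ⊥-elim (¬uv a)
    adj⇒next (suc (suc zero)) zero             a = ⊥-elim (¬uv (Adj-sym G a))
    next⇒adj : ∀ i j → ℕ.suc (toℕ i) ≡ toℕ j ⊎ ℕ.suc (toℕ j) ≡ toℕ i → Adj G (f i) (f j)
    next⇒adj zero             (suc zero)       _ = Adj-sym G xu
    next⇒adj (suc zero)       zero             _ = xu
    next⇒adj (suc zero)       (suc (suc zero)) _ = xv
    next⇒adj (suc (suc zero)) (suc zero)       _ = Adj-sym G xv
    next⇒adj zero             zero             (inj₁ ())
    next⇒adj zero             zero             (inj₂ ())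
    next⇒adj zero             (suc (suc zero)) (inj₁ ())
    next⇒adj zero             (suc (suc zero)) (inj₂ ())
    next⇒adj (suc zero)       (suc zero)       (inj₁ ())
    next⇒adj (suc zero)       (suc zero)       (inj₂ ())
    next⇒adj (suc (suc zero)) zero             (inj₁ ())
    next⇒adj (suc (suc zero)) zero             (inj₂ ())
    next⇒adj (suc (suc zero)) (suc (suc zero)) (inj₁ ())
    next⇒adj (suc (suc zero)) (suc (suc zero)) (inj₂ ())

  no-common-neighbour : (∀ a b → ¬ ProperK2Cutset G a b) →
    ¬ InducedChordlessPath G (WithPair G (C₁ s) u v) u v → ¬ ∃Propeller G′ →
    ∀ {x} → In₁ x → Adj G x u → ¬ Adj G x v
  no-common-neighbour noK2 ¬path ¬P′ cx xu xv =
    ¬path (uxv-chordless cx xu xv (common-neighbour-alone noK2 ¬P′ cx xu xv))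

  marker-degree₂ : ∀ {p q} (e : Ends G u v p q) {L} → TwoNeighbours G′ (marker e) L →
                   marker (Ends-flip e) ∈ L
  marker-degree₂ e n = proj₁ (proj₁ (TwoNeighbours-both (λ _ → marker-neighbours e _) n))

  -- v′ has degree two, so a rim avoiding u′ avoids v′ too, and so does the centre.
  rim-old : ∀ {c} (P : Propeller G′ c) → u′ ∉ Propeller.rim P →
            All Old (Propeller.rim P) × Old (Propeller.centre P)
  rim-old P u′∉ = All.tabulate old , centre-old
    where
    open Propeller P
    v′∉ : v′ ∉ rim
    v′∉ v′∈ = u′∉ (marker-degree₂ vu (Propeller-rimNeighbours P v′∈))
    old : ∀ {w} → w ∈ rim → Old w
    old w∈ = Old-unless-marker uv (λ { refl → u′∉ w∈ }) (λ { refl → v′∉ w∈ })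
    centre-old : Old centre
    centre-old = Old-unless-marker uv (λ { refl → v′∉ (marker-degree₂ uv spokes) })
                                      (λ { refl → u′∉ (marker-degree₂ vu spokes) })

  In₁′-unless : ∀ {p q} (e : Ends G u v p q) {w} → w ≢ marker e → w ≢ marker (Ends-flip e) →
               w ≢ ι p → w ≢ ι q → In₁′ w
  In₁′-unless e {w} ≢X ≢Y ≢ιp ≢ιq with Old-unless-marker e ≢X ≢Y
  ... | old with InW-elim (π-InW old)
  ... | inj₁ c  = old , c
  ... | inj₂ pr with Ends-pair e pr
  ...   | inj₁ refl = ⊥-elim (≢ιp (Old⇒ι-π old))
  ...   | inj₂ refl = ⊥-elim (≢ιq (Old⇒ι-π old))

  markedRim-shape : ∀ {p q K} (e : Ends G u v p q) (P : Propeller G′ (marker e)) →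
    Propeller.rest P ≡ marker (Ends-flip e) ∷ K →
    Σ (List (V G′)) λ M → Propeller.rest P ≡ marker (Ends-flip e) ∷ ι q ∷ M ∷ʳ ι p
  markedRim-shape {p} {q} e P eq with Propeller-ends P
  ... | d , T , b , eq′ , d≢b , Xd , Xb with trans (sym eq) eq′
  ... | refl with marker-neighbours e b Xb
  ... | inj₁ refl = ⊥-elim (d≢b refl)
  ... | inj₂ refl with after-Y T (subst (λ R → Linked (Adj G′) (X ∷ R ∷ʳ X)) eq′ (Propeller.linked P))
                                 (subst (Unique ∘ (X ∷_)) eq′ (Propeller.unique P))
    where
    X Y : V G′
    X = marker e
    Y = marker (Ends-flip e)
    X≡ : marker (Ends-flip (Ends-flip e)) ≡ X
    X≡ = cong marker (Ends-flip-involutive e)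
    wp : InW p
    wp = Ends-InW e
    wq : InW q
    wq = Ends-InW (Ends-flip e)
    after-Y : ∀ T → Linked (Adj G′) (X ∷ Y ∷ T ∷ʳ ι p ∷ʳ X) → Unique (X ∷ Y ∷ T ∷ʳ ι p) →
              Σ (List (V G′)) λ M → T ∷ʳ ι p ≡ ι q ∷ M ∷ʳ ι p
    after-Y [] (_ ∷ Yιp ∷ _) _ with marker-neighbours (Ends-flip e) (ι p) Yιp
    ... | inj₁ ιp≡X  = ⊥-elim (¬Old-marker e (subst Old (trans ιp≡X X≡) (Old-ι wp)))
    ... | inj₂ ιp≡ιq = ⊥-elim (Ends-≢ e (EmbeddingOn.injective ι-embedding wp wq ιp≡ιq))
    after-Y (a ∷ M) (_ ∷ Ya ∷ _) (X∉ ∷ _) with marker-neighbours (Ends-flip e) a Ya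
    ... | inj₁ a≡X = ⊥-elim (All.lookup X∉ (there (here refl)) (sym (trans a≡X X≡)))
    ... | inj₂ refl = M , refl
  ... | M , eq″ = M , trans eq′ (cong (marker (Ends-flip e) ∷_) eq″)

  -- Rotating the rim to ι q and cutting off the two markers leaves a fan of G′.
  markedRim⇒Fan′ : ∀ {p q M} (e : Ends G u v p q) (P : Propeller G′ (marker e)) →
    Propeller.rest P ≡ marker (Ends-flip e) ∷ ι q ∷ M ∷ʳ ι p →
    Fan G′ In₁′ (ι q) (ι p)
  markedRim⇒Fan′ {p} {q} {M} e P eq =
    Propeller⇒Fan P″ (trans eq″ (++-assoc M (ι p ∷ []) (X ∷ Y ∷ []))) (All.tabulate new) blind
    where
    open Propeller P
    X Y : V G′
    X = marker e
    Y = marker (Ends-flip e)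
    P″ : Propeller G′ (ι q)
    P″ = proj₁ (Propeller-rotateAt (Y ∷ []) (ι q) (M ∷ʳ ι p) P eq)
    eq″ : Propeller.rest P″ ≡ (M ∷ʳ ι p) ++ X ∷ Y ∷ []
    eq″ = proj₂ (Propeller-rotateAt (Y ∷ []) (ι q) (M ∷ʳ ι p) P eq)
    X≡ : marker (Ends-flip (Ends-flip e)) ≡ X
    X≡ = cong marker (Ends-flip-involutive e)
    inRim : ∀ {z} → z ∈ X ∷ Y ∷ ι q ∷ M ∷ʳ ι p → z ∈ rim
    inRim = subst (λ R → _ ∈ X ∷ R) (sym eq)
    ιp∈ : ι p ∈ X ∷ Y ∷ ι q ∷ M ∷ʳ ι p
    ιp∈ = there (there (there (∈-++⁺ʳ M (here refl))))
    unique′ : Unique (X ∷ Y ∷ ι q ∷ M ∷ʳ ι p)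
    unique′ = subst (Unique ∘ (X ∷_)) eq unique
    new : ∀ {z} → z ∈ M → In₁′ z
    new z∈ with unique′
    ... | X∉ ∷ Y∉ ∷ ιq∉ ∷ uM =
      In₁′-unless e (λ z≡X → All.lookup X∉ (there (there (∈-++⁺ˡ z∈))) (sym z≡X))
                   (λ z≡Y → All.lookup Y∉ (there (∈-++⁺ˡ z∈)) (sym z≡Y))
                   (λ z≡ιp → proj₂ (proj₂ (Unique-++⁻ M uM)) (z∈ , here z≡ιp))
                   (λ z≡ιq → All.lookup ιq∉ (∈-++⁺ˡ z∈) (sym z≡ιq))
    blind : ∀ {z} → z ∈ X ∷ Y ∷ [] → ¬ Adj G′ centre z
    blind (here refl) cX with marker-neighbours e centre (Adj-sym G′ {centre} cX)
    ... | inj₁ refl = centre∉ (inRim (there (here refl)))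
    ... | inj₂ refl = centre∉ (inRim ιp∈)
    blind (there (here refl)) cY with marker-neighbours (Ends-flip e) centre (Adj-sym G′ {centre} cY)
    ... | inj₁ c≡X  = centre∉ (inRim (here (trans c≡X X≡)))
    ... | inj₂ refl = centre∉ (inRim (there (there (here refl))))

  -- In G the markers are replaced by the given path p … q through C₂.
  markedRim⇒Propeller : (∀ {p q} → Ends G u v p q → Path G In₂ p q) →
    ∀ {p q K} (e : Ends G u v p q) (P : Propeller G′ (marker e)) →
    Propeller.rest P ≡ marker (Ends-flip e) ∷ K → ∃Propeller G
  markedRim⇒Propeller paths {p} {q} e P eq with markedRim-shape e P eq
  ... | M , eq′ =
    q , Fan+Path⇒Propeller (Ends-≢ e ∘ sym) (Ends-¬adj e ∘ Adj-sym G)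
          (λ c → In₁⇒¬Pair c ∘ Ends-pair⁻ (Ends-flip e))
          (λ c → out₂ s _ c ∘ Ends-pair⁻ (Ends-flip e))
          In₁⇒¬In₂ F (InW⇒¬In₂ (π-InW old-centre)) (paths e)
    where
    open Propeller P
    wp : InW p
    wp = Ends-InW e
    wq : InW q
    wq = Ends-InW (Ends-flip e)
    F′ : Fan G′ In₁′ (ι q) (ι p)
    F′ = markedRim⇒Fan′ e P eq′
    old-centre : Old centre
    old-centre = Old-unless-marker e (λ c≡X → centre∉ (here c≡X))
                                     (λ c≡Y → centre∉ (there (subst (_ ∈_) (sym eq) (here c≡Y))))
    old-vertices : All Old (Fan.vertices F′)
    old-vertices = Old-ι wq ∷ All.∷ʳ⁺ (All.map proj₁ (Fan.inside F′)) (Old-ι wp)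
    F : Fan G In₁ q p
    F = Fan-cast (π-ι wq) (π-ι wp)
          (Fan-map π-embedding F′ old-vertices old-centre (All.map proj₂ (Fan.inside F′)))

  Propeller′⇒Propeller : (∀ {p q} → Ends G u v p q → Path G In₂ p q) →
                         ∃Propeller G′ → ∃Propeller G
  Propeller′⇒Propeller paths (c , P) with u′ ∈? Propeller.rim P
    where open DecMembership (_≟_ G′) using (_∈?_)
  ... | no u′∉ = π c , Propeller-map π-embedding P (proj₁ (rim-old P u′∉)) (proj₂ (rim-old P u′∉))
  ... | yes u′∈ with Propeller-rotate P u′∈
  ... | P₁ , _ with Propeller-ends P₁
  ... | d , T , b , eq , d≢b , u′d , u′b with marker-neighbours uv d u′d | marker-neighbours uv b u′b
  ...   | inj₁ refl | _         = markedRim⇒Propeller paths uv P₁ eq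
  ...   | inj₂ refl | inj₁ refl =
    uncurry (markedRim⇒Propeller paths vu) (Propeller-rotateAt (ι u ∷ T) v′ [] P₁ eq)
  ...   | inj₂ refl | inj₂ refl = ⊥-elim (d≢b refl)

  arc⇒Propeller′ : ∀ {p q M N} → Ends G u v p q →
                   (P : Propeller G p) → Propeller.rest P ≡ M ++ q ∷ N → All In₁ M → In₁ (Propeller.centre P) → All In₂ N → ∃Propeller G′
  arc⇒Propeller′ e P eq cM cx c₂N =
    Fan⇒Propeller′ e (Propeller⇒Fan P eq cM λ z∈N → no-edge s _ _ cx (All.lookup c₂N z∈N)) cx

  -- A propeller with rim in C₁ ∪ {u, v} is one of G′, unless its centre lies in C₂;
  -- then its two spokes can only be u and v.
  rimInW⇒⊥ : ¬ ∃Propeller G′ → (∀ {x} → In₂ x → Adj G x u → ¬ Adj G x v) →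
             ∀ {c} (P : Propeller G c) → All InW (Propeller.rim P) → ⊥
  rimInW⇒⊥ ¬P′ ¬common {c} P wRim with T? (WithPair G (C₁ s) u v (Propeller.centre P))
  ... | yes wx = ¬P′ (ι c , Propeller-map ι-embedding P wRim wx)
  ... | no ¬wx with cover s centre (¬wx ∘ InW-intro ∘ inj₂)
    where open Propeller P
  ...   | inj₁ c₁ = ¬wx (InW-intro (inj₁ c₁))
  ...   | inj₂ c₂ = ¬common c₂ (proj₂ (proj₁ both)) (proj₂ (proj₂ both))
    where
    open Propeller P
    spoke-end : ∀ {y} → y ∈ rim → Adj G centre y → Pair G u v y
    spoke-end y∈ xy with InW-elim (All.lookup wRim y∈)
    ... | inj₁ c₁ = ⊥-elim (no-edge s _ _ c₁ c₂ (Adj-sym G xy))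
    ... | inj₂ pr = pr
    both : (u ∈ rim × Adj G centre u) × (v ∈ rim × Adj G centre v)
    both = TwoNeighbours-both spoke-end spokes

  arcs-InW : ∀ {M N} → All In₁ M → All In₁ N → All InW (u ∷ M ++ v ∷ N)
  arcs-InW cM cN =
    Ends-InW uv ∷ All.++⁺ (All.map (InW-intro ∘ inj₁) cM) (Ends-InW vu ∷ All.map (InW-intro ∘ inj₁) cN)

  InW-neighbour : ∀ {y h} → In₁ y → Adj G y h → InW h
  InW-neighbour {h = h} c yh with T? (WithPair G (C₁ s) u v h)
  ... | yes w = w
  ... | no ¬w = ⊥-elim (¬w (InW-intro (inj₁ (In₁-step c yh (¬w ∘ InW-intro ∘ inj₂)))))

module Cutset (G : Graph) {u v : V G} (u≢v : u ≢ v) (¬uv : ¬ Adj G u v) (s : Split G u v) where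

  -- S₂ is the same development for the swapped split: S₂.In₁ is C₂ and S₂.G′ is G″.
  module S₁ = Side G u≢v ¬uv s
  module S₂ = Side G u≢v ¬uv (Split-swap s)
  open DecMembership (_≟_ G) using (_∈?_)

  no-Propeller′ : TwoConnected G → ¬ ∃Propeller G → ¬ ∃Propeller S₁.G′
  no-Propeller′ tc ¬P P′ = S₂.sidePaths tc λ paths → ¬P (S₁.Propeller′⇒Propeller paths P′)

  module _ (noK2 : ∀ a b → ¬ ProperK2Cutset G a b)
           (¬path₁ : ¬ InducedChordlessPath G (WithPair G (C₁ s) u v) u v)
           (¬path₂ : ¬ InducedChordlessPath G (WithPair G (C₂ s) u v) u v)
           (¬P′ : ¬ ∃Propeller S₁.G′) (¬P″ : ¬ ∃Propeller S₂.G′) where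

    rimIn₁⇒⊥ : ∀ {c} (P : Propeller G c) → All S₁.InW (Propeller.rim P) → ⊥
    rimIn₁⇒⊥ = S₁.rimInW⇒⊥ ¬P′ (S₂.no-common-neighbour noK2 ¬path₂ ¬P″)

    rimIn₂⇒⊥ : ∀ {c} (P : Propeller G c) → All S₂.InW (Propeller.rim P) → ⊥
    rimIn₂⇒⊥ = S₂.rimInW⇒⊥ ¬P″ (S₁.no-common-neighbour noK2 ¬path₁ ¬P′)

    Linked-side : ∀ {L} → Linked (Adj G) L → All (¬_ ∘ Pair G u v) L → All S₁.In₁ L ⊎ All S₂.In₁ L
    Linked-side {[]}    _ _            = inj₁ []
    Linked-side {y ∷ L} l (¬pr ∷ ¬prs) with cover s y ¬pr
    ... | inj₁ c₁ = inj₁ (c₁ ∷ S₁.Linked-In₁ c₁ l ¬prs)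
    ... | inj₂ c₂ = inj₂ (c₂ ∷ S₂.Linked-In₁ c₂ l ¬prs)

    rest-avoiding⇒⊥ : ∀ {h} (P : Propeller G h) → u ∉ Propeller.rest P → v ∉ Propeller.rest P → ⊥
    rest-avoiding⇒⊥ record { rest = [] ; long = () }
    rest-avoiding⇒⊥ P@record { rest = d ∷ R ; linked = hd ∷ l } u∉ v∉
      with Linked-side (Linked-++⁻ˡ (d ∷ R) l)
                       (All.tabulate λ { z∈ (inj₁ refl) → u∉ z∈ ; z∈ (inj₂ refl) → v∉ z∈ })
    ... | inj₁ c = rimIn₁⇒⊥ P
                     (S₁.InW-neighbour (All.head c) (Adj-sym G hd) ∷ All.map (S₁.InW-intro ∘ inj₁) c)
    ... | inj₂ c = rimIn₂⇒⊥ P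
                     (S₂.InW-neighbour (All.head c) (Adj-sym G hd) ∷ All.map (S₂.InW-intro ∘ inj₁) c)

    mixed⇒⊥ : ∀ {p q M N} (e : Ends G u v p q) (P : Propeller G p) → Propeller.rest P ≡ M ++ q ∷ N →
              All S₁.In₁ M → All S₂.In₁ N → ⊥
    mixed⇒⊥ {p} {q} {M} {N} e P eq c₁M c₂N with cover s (Propeller.centre P) ¬pair
      where
      open Propeller P
      ¬pair : ¬ Pair G u v centre
      ¬pair pr with Ends-pair e pr
      ... | inj₁ refl = centre∉ (here refl)
      ... | inj₂ refl = centre∉ (there (subst (centre ∈_) (sym eq) (∈-++⁺ʳ M (here refl))))
    ... | inj₁ cx = ¬P′ (S₁.arc⇒Propeller′ e P eq c₁M cx c₂N)
    ... | inj₂ cx = let P₂ , eq₂ = Propeller-rotateAt M q N P eq in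
                    ¬P″ (S₂.arc⇒Propeller′ (Ends-flip e) P₂ eq₂ c₂N cx c₁M)

    through-both⇒⊥ : ∀ {M N} (P : Propeller G u) → Propeller.rest P ≡ M ++ v ∷ N → ⊥
    through-both⇒⊥ {M} {N} P eq with Linked-side linkedM (proj₁ (Propeller-arcs-avoid P eq))
                                   | Linked-side linkedN (proj₂ (Propeller-arcs-avoid P eq))
      where
      linkedM : Linked (Adj G) M
      linkedM = Linked-++⁻ˡ M (Linked.tail (proj₁ (Propeller-arcs P eq)))
      linkedN : Linked (Adj G) N
      linkedN = Linked-++⁻ˡ N (Linked.tail (proj₂ (Propeller-arcs P eq)))
    ... | inj₁ c₁M | inj₁ c₁N = rimIn₁⇒⊥ P (subst (All S₁.InW ∘ (u ∷_)) (sym eq) (S₁.arcs-InW c₁M c₁N))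
    ... | inj₂ c₂M | inj₂ c₂N = rimIn₂⇒⊥ P (subst (All S₂.InW ∘ (u ∷_)) (sym eq) (S₂.arcs-InW c₂M c₂N))
    ... | inj₁ c₁M | inj₂ c₂N = mixed⇒⊥ uv P eq c₁M c₂N
    ... | inj₂ c₂M | inj₁ c₁N = uncurry (mixed⇒⊥ vu) (Propeller-rotateAt M v N P eq) c₁N c₂M

    no-Propeller : ¬ ∃Propeller G
    no-Propeller (c , P) with u ∈? Propeller.rim P
    ... | yes u∈ with Propeller-rotate P u∈
    ...   | P₁ , _ with v ∈? Propeller.rest P₁
    ...     | yes v∈ = through-both⇒⊥ P₁ (proj₂ (proj₂ (∈-∃++ v∈)))
    ...     | no v∉  = rest-avoiding⇒⊥ P₁ (Propeller-start∉rest P₁) v∉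
    no-Propeller (c , P) | no u∉ with v ∈? Propeller.rim P
    ... | yes v∈ with Propeller-rotate P v∈
    ...   | P₁ , P₁⊆P = rest-avoiding⇒⊥ P₁ (u∉ ∘ P₁⊆P ∘ there) (Propeller-start∉rest P₁)
    no-Propeller (c , P) | no u∉ | no v∉ = rest-avoiding⇒⊥ P (u∉ ∘ there) (v∉ ∘ there)

lemma4p3 : (G : Graph) → Finite G → TwoConnected G →
    (∀ a b → ¬ ProperK2Cutset G a b) →
    (u v : V G) → S2Cutset G u v → (s : Split G u v) →
    ¬ InducedChordlessPath G (WithPair G (C₁ s) u v) u v →
    ¬ InducedChordlessPath G (WithPair G (C₂ s) u v) u v →
    (¬ ContainsPropeller G →
        ¬ ContainsPropeller (Glue G (C₁ s) u v) × ¬ ContainsPropeller (Glue G (C₂ s) u v))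
    × (¬ ContainsPropeller (Glue G (C₁ s) u v) × ¬ ContainsPropeller (Glue G (C₂ s) u v) →
        ¬ ContainsPropeller G)
lemma4p3 G _ tc noK2 u v (u≢v , ¬uv , _) s ¬path₁ ¬path₂ =
  (λ ¬CP → glued-side s ¬CP , glued-side (Split-swap s) ¬CP) ,
  λ (¬CP′ , ¬CP″) → Cutset.no-Propeller G u≢v ¬uv s noK2 ¬path₁ ¬path₂
                      (¬CP′ ∘ ∃Propeller⇒ContainsPropeller) (¬CP″ ∘ ∃Propeller⇒ContainsPropeller)
                    ∘ ContainsPropeller⇒∃Propeller
  where
  glued-side : (t : Split G u v) → ¬ ContainsPropeller G → ¬ ContainsPropeller (Glue G (C₁ t) u v)
  glued-side t ¬CP = Cutset.no-Propeller′ G u≢v ¬uv t tc (¬CP ∘ ∃Propeller⇒ContainsPropeller)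
                     ∘ ContainsPropeller⇒∃Propeller
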